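{- For $p\in(0,1)$, define $N(k,\ell,p)$ for integers $k\ge2$, $\ell\ge1$ recursively by $$N(2,\ell,p)=\ell^2\sum_{i=1}^{\ell-1}i^2\binom{\ell-1}{i}p^i(1-p)^{\ell-1-i},\qquad N(k,\ell,p)=\ell^2\sum_{i=k-1}^{\ell-1}N(k-1,i,p)\binom{\ell-1}{i}p^i(1-p)^{\ell-1-i}\ (k\ge3).$$ Then for every $k\ge 2$ there are functions $f_{k,j}(p)$ (for integers $j$), depending on $k,j,p$ but independent of $\ell$, such that for all $\ell$, $$N(k,\ell,p)=\sum_{j=k}^{2k-1}\ell\,(\ell)_j\,f_{k,j}(p),$$ and these functions satisfy: (i) $f_{k,k-i}(p)=0$ for all $i\in\{1,\dots,k\}$ and $f_{k,2k+i}(p)=0$ for all $i\ge0$; (ii) $f_{k+1,j}(p)=p^{j-1}\big((j-1)f_{k,j-1}(p)+f_{k,j-2}(p)\big)$.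
   Context: $(\ell)_j=\ell(\ell-1)\cdots(\ell-j+1)$ denotes the falling factorial (equal to $0$ when $j>\ell$). -}

module Defs where

open import Level using (Level)
open import Algebra.Bundles using (CommutativeRing)
open import Data.Nat using (ℕ; zero; suc; _∸_; _≤_)
import Data.Nat as ℕ
open import Data.Nat.Combinatorics using (_C_; _P_)

module Binomial {c ℓr : Level} (R : CommutativeRing c ℓr) where
  open CommutativeRing R

  ι : ℕ → Carrier
  ι zero    = 0#
  ι (suc n) = 1# + ι n

  pow : Carrier → ℕ → Carrier
  pow x zero    = 1#
  pow x (suc n) = x * pow x n

  sumBelow : ℕ → (ℕ → Carrier) → Carrier
  sumBelow zero    g = 0#
  sumBelow (suc n) g = sumBelow n g + g n

  -- Σ_{i = a}^{b} g i  (empty when b < a)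
  sumFromTo : ℕ → ℕ → (ℕ → Carrier) → Carrier
  sumFromTo a b g = sumBelow (suc b ∸ a) (λ t → g (a ℕ.+ t))

  weight : Carrier → ℕ → ℕ → Carrier
  weight p ℓ i = ι ((ℓ ∸ 1) C i) * (pow p i * pow (1# - p) ((ℓ ∸ 1) ∸ i))

  -- N(k, ℓ, p); only meaningful for k ≥ 2 (value 0 for k = 0, 1)
  N : ℕ → ℕ → Carrier → Carrier
  N zero ℓ p = 0#
  N (suc zero) ℓ p = 0#
  N (suc (suc zero)) ℓ p =
    ι (ℓ ℕ.* ℓ) * sumFromTo 1 (ℓ ∸ 1) (λ i → ι (i ℕ.* i) * weight p ℓ i)
  N (suc (suc (suc k))) ℓ p =
    ι (ℓ ℕ.* ℓ) * sumFromTo (suc (suc k)) (ℓ ∸ 1)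
      (λ i → N (suc (suc k)) i p * weight p ℓ i)

  -- falling factorial (ℓ)_j is the library's  ℓ P j  (0 when j > ℓ)

-- Write q = 1 - p and E_n[h] = Σ_{i ≤ n} C(n,i) p^i q^(n-i) h(i) for the binomial
-- expectation, so that N(k+1, ℓ) = ℓ² E_{ℓ-1}[N(k, ·)].  Falling factorials are the
-- moments of this expectation:  E_n[(i)_m] = (n)_m p^m,  proved by induction on n from
-- Pascal's rule  E_{n+1}[h] = q E_n[h] + p E_n[h ∘ suc].  Call Φ_g(ℓ) = Σ_j ℓ (ℓ)_j g_j the
-- falling-factorial polynomial with coefficients g.  Since  i (i)_j = (i)_{j+1} + j (i)_j
-- and  ℓ² (ℓ-1)_m = ℓ (ℓ)_{m+1},  the operator h ↦ ℓ² E_{ℓ-1}[h] maps Φ_g to Φ_{σg} where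
-- (σg)_J = p^(J-1) ((J-1) g_{J-1} + g_{J-2}).  Starting from f_1 = [j = 1] (so that
-- Φ_{f_1}(i) = i², the summand of N(2, ℓ)) and putting f_{k+1} = σ f_k, induction on k gives
-- N(k, ℓ) = Φ_{f_k}(ℓ).  The support of f_k lies in [k, 2k-1], which yields the vanishing
-- statements and the summation range of the theorem.

module Submission where

open import Defs
open import Level using (Level)
open import Algebra.Bundles using (CommutativeRing)
open import Data.Nat using (ℕ; zero; suc; _∸_; _≤_; _<_; s≤s; _≤ᵇ_)
import Data.Nat as ℕ
import Data.Nat.Properties as NP
open import Data.Nat.Combinatorics using (_C_; _P_; nCk+nC[k+1]≡[n+1]C[k+1])
open import Data.Nat.Combinatorics.Base using (_P′_)
open import Data.Nat.Combinatorics.Specification using (k>n⇒nCk≡0)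
open import Data.Bool using (true; false; T)
open import Data.Product using (Σ; _×_; _,_)
open import Relation.Nullary using (yes; no)
open import Relation.Binary.PropositionalEquality as Eq using (_≡_)
import Algebra.Properties.CommutativeSemigroup as CommSemigroupProperties

module FallingFactorial where
  open Eq using (refl; sym; trans; cong)
  open Eq.≡-Reasoning
  open CommSemigroupProperties NP.+-commutativeSemigroup using (x∙yz≈y∙xz)

  falling : ℕ → ℕ → ℕ
  falling n       zero    = 1
  falling zero    (suc k) = 0
  falling (suc n) (suc k) = suc n ℕ.* falling n k

  falling-snoc : ∀ n k → falling n (suc k) ≡ (n ∸ k) ℕ.* falling n k
  falling-snoc zero    zero    = refl
  falling-snoc zero    (suc k) = refl
  falling-snoc (suc n) zero    = refl
  falling-snoc (suc n) (suc k) = begin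
    suc n ℕ.* falling n (suc k)          ≡⟨ cong (suc n ℕ.*_) (falling-snoc n k) ⟩
    suc n ℕ.* ((n ∸ k) ℕ.* falling n k)  ≡⟨ NP.*-assoc (suc n) (n ∸ k) _ ⟨
    suc n ℕ.* (n ∸ k) ℕ.* falling n k    ≡⟨ cong (ℕ._* falling n k) (NP.*-comm (suc n) (n ∸ k)) ⟩
    (n ∸ k) ℕ.* suc n ℕ.* falling n k    ≡⟨ NP.*-assoc (n ∸ k) (suc n) _ ⟩
    (n ∸ k) ℕ.* (suc n ℕ.* falling n k)  ∎

  falling-vanishes : ∀ n k → n < k → falling n k ≡ 0
  falling-vanishes zero    (suc k) _       = refl
  falling-vanishes (suc n) (suc k) (s≤s n<k) =
    trans (cong (suc n ℕ.*_) (falling-vanishes n k n<k)) (NP.*-zeroʳ (suc n))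

  falling-one : ∀ n → falling n 1 ≡ n
  falling-one zero    = refl
  falling-one (suc n) = NP.*-identityʳ (suc n)

  P′≡falling : ∀ n k → n P′ k ≡ falling n k
  P′≡falling n zero    = refl
  P′≡falling n (suc k) = trans (cong ((n ∸ k) ℕ.*_) (P′≡falling n k)) (sym (falling-snoc n k))

  P≡falling : ∀ n k → n P k ≡ falling n k
  P≡falling n k with k ≤ᵇ n in k≤ᵇn
  ... | true  = P′≡falling n k
  ... | false = sym (falling-vanishes n k (NP.≰⇒> λ k≤n → Eq.subst T k≤ᵇn (NP.≤⇒≤ᵇ k≤n)))

  falling-absorb : ∀ i j → i ℕ.* falling i j ≡ falling i (suc j) ℕ.+ j ℕ.* falling i j
  falling-absorb i j with j NP.≤? i
  ... | yes j≤i = begin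
    i ℕ.* falling i j                          ≡⟨ cong (ℕ._* falling i j) (NP.m∸n+n≡m j≤i) ⟨
    (i ∸ j ℕ.+ j) ℕ.* falling i j              ≡⟨ NP.*-distribʳ-+ (falling i j) (i ∸ j) j ⟩
    (i ∸ j) ℕ.* falling i j ℕ.+ j ℕ.* falling i j
                                               ≡⟨ cong (ℕ._+ j ℕ.* falling i j) (falling-snoc i j) ⟨
    falling i (suc j) ℕ.+ j ℕ.* falling i j    ∎
  ... | no j≰i = trans lhs≡0 (sym rhs≡0)
    where
    vanish : ∀ m → j ≤ m → falling i m ≡ 0
    vanish m j≤m = falling-vanishes i m (NP.<-≤-trans (NP.≰⇒> j≰i) j≤m)
    lhs≡0 : i ℕ.* falling i j ≡ 0
    lhs≡0 = trans (cong (i ℕ.*_) (vanish j NP.≤-refl)) (NP.*-zeroʳ i)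
    rhs≡0 : falling i (suc j) ℕ.+ j ℕ.* falling i j ≡ 0
    rhs≡0 = Eq.cong₂ ℕ._+_ (vanish (suc j) (NP.n≤1+n j))
              (trans (cong (j ℕ.*_) (vanish j NP.≤-refl)) (NP.*-zeroʳ j))

  falling-pascal : ∀ i m → falling (suc i) (suc m) ≡ falling i (suc m) ℕ.+ suc m ℕ.* falling i m
  falling-pascal i m = begin
    falling i m ℕ.+ i ℕ.* falling i m
      ≡⟨ cong (falling i m ℕ.+_) (falling-absorb i m) ⟩
    falling i m ℕ.+ (falling i (suc m) ℕ.+ m ℕ.* falling i m)
      ≡⟨ x∙yz≈y∙xz (falling i m) (falling i (suc m)) _ ⟩
    falling i (suc m) ℕ.+ suc m ℕ.* falling i m ∎

  -- twice k = 2k, by a recursion matching the growth of the coefficient support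
  twice : ℕ → ℕ
  twice zero    = 0
  twice (suc k) = suc (suc (twice k))

  twice≡2* : ∀ k → twice k ≡ 2 ℕ.* k
  twice≡2* zero    = refl
  twice≡2* (suc k) = cong suc (trans (cong suc (twice≡2* k)) (sym (NP.+-suc k (k ℕ.+ 0))))

open FallingFactorial

module Sums {c ℓr : Level} (R : CommutativeRing c ℓr) where
  open CommutativeRing R
  open Binomial R using (sumBelow; sumFromTo)
  open import Relation.Binary.Reasoning.Setoid setoid
  open import Algebra.Solver.Ring.NaturalCoefficients.Default commutativeSemiring

  sum-cong< : ∀ n {g h : ℕ → Carrier} → (∀ i → i < n → g i ≈ h i) → sumBelow n g ≈ sumBelow n h
  sum-cong< zero    g≈h = refl
  sum-cong< (suc n) g≈h =
    +-cong (sum-cong< n (λ i i<n → g≈h i (NP.m<n⇒m<1+n i<n))) (g≈h n (NP.n<1+n n))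

  sum-cong : ∀ n {g h : ℕ → Carrier} → (∀ i → g i ≈ h i) → sumBelow n g ≈ sumBelow n h
  sum-cong n g≈h = sum-cong< n (λ i _ → g≈h i)

  sum-vanishes : ∀ n {g : ℕ → Carrier} → (∀ i → i < n → g i ≈ 0#) → sumBelow n g ≈ 0#
  sum-vanishes zero    g≈0 = refl
  sum-vanishes (suc n) g≈0 =
    trans (+-cong (sum-vanishes n (λ i i<n → g≈0 i (NP.m<n⇒m<1+n i<n))) (g≈0 n (NP.n<1+n n)))
          (+-identityʳ 0#)

  sum-length : ∀ {m n} (g : ℕ → Carrier) → m ≡ n → sumBelow m g ≈ sumBelow n g
  sum-length g Eq.refl = refl

  sum-+ : ∀ n (g h : ℕ → Carrier) → sumBelow n (λ i → g i + h i) ≈ sumBelow n g + sumBelow n h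
  sum-+ zero    g h = sym (+-identityʳ 0#)
  sum-+ (suc n) g h = trans (+-congʳ (sum-+ n g h))
    (solve 4 (λ a b c d → (a :+ b) :+ (c :+ d) := (a :+ c) :+ (b :+ d)) refl _ _ _ _)

  sum-*ˡ : ∀ n x (g : ℕ → Carrier) → x * sumBelow n g ≈ sumBelow n (λ i → x * g i)
  sum-*ˡ zero    x g = zeroʳ x
  sum-*ˡ (suc n) x g = trans (distribˡ x _ _) (+-congʳ (sum-*ˡ n x g))

  sum-head : ∀ n (g : ℕ → Carrier) → sumBelow (suc n) g ≈ g 0 + sumBelow n (λ t → g (suc t))
  sum-head zero    g = +-comm 0# (g 0)
  sum-head (suc n) g = trans (+-congʳ (sum-head n g)) (+-assoc _ _ _)

  sum-drop-head : ∀ n (g : ℕ → Carrier) → g 0 ≈ 0# →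
                  sumBelow (suc n) g ≈ sumBelow n (λ t → g (suc t))
  sum-drop-head n g g0≈0 = trans (sum-head n g) (trans (+-congʳ g0≈0) (+-identityˡ _))

  sum-shift : ∀ n (g : ℕ → Carrier) → g 0 ≈ 0# → g n ≈ 0# →
              sumBelow n g ≈ sumBelow n (λ t → g (suc t))
  sum-shift n g g0≈0 gn≈0 = begin
    sumBelow n g                    ≈⟨ +-identityʳ _ ⟨
    sumBelow n g + 0#               ≈⟨ +-congˡ gn≈0 ⟨
    sumBelow (suc n) g              ≈⟨ sum-drop-head n g g0≈0 ⟩
    sumBelow n (λ t → g (suc t))    ∎

  sum-split : ∀ a b (g : ℕ → Carrier) →
              sumBelow (a ℕ.+ b) g ≈ sumBelow a g + sumBelow b (λ t → g (a ℕ.+ t))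
  sum-split zero    b g = sym (+-identityˡ _)
  sum-split (suc a) b g = begin
    sumBelow (suc (a ℕ.+ b)) g
      ≈⟨ sum-head (a ℕ.+ b) g ⟩
    g 0 + sumBelow (a ℕ.+ b) (λ t → g (suc t))
      ≈⟨ +-congˡ (sum-split a b (λ t → g (suc t))) ⟩
    g 0 + (sumBelow a (λ t → g (suc t)) + sumBelow b (λ t → g (suc a ℕ.+ t)))
      ≈⟨ +-assoc _ _ _ ⟨
    (g 0 + sumBelow a (λ t → g (suc t))) + sumBelow b (λ t → g (suc a ℕ.+ t))
      ≈⟨ +-congʳ (sum-head a g) ⟨
    sumBelow (suc a) g + sumBelow b (λ t → g (suc a ℕ.+ t)) ∎

  sum-swap : ∀ n m (F : ℕ → ℕ → Carrier) →
    sumBelow n (λ i → sumBelow m (F i)) ≈ sumBelow m (λ j → sumBelow n (λ i → F i j))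
  sum-swap zero    m F = sym (sum-vanishes m (λ _ _ → refl))
  sum-swap (suc n) m F = trans (+-congʳ (sum-swap n m F))
    (sym (sum-+ m (λ j → sumBelow n (λ i → F i j)) (F n)))

  sumFromTo-extend : ∀ a n (g : ℕ → Carrier) → (∀ i → i < a → g i ≈ 0#) →
                     sumFromTo a n g ≈ sumBelow (suc n) g
  sumFromTo-extend a n g below with a NP.≤? suc n
  ... | yes a≤n+1 = begin
    sumBelow (suc n ∸ a) (λ t → g (a ℕ.+ t))                ≈⟨ +-identityˡ _ ⟨
    0# + sumBelow (suc n ∸ a) (λ t → g (a ℕ.+ t))           ≈⟨ +-congʳ (sum-vanishes a below) ⟨
    sumBelow a g + sumBelow (suc n ∸ a) (λ t → g (a ℕ.+ t)) ≈⟨ sum-split a (suc n ∸ a) g ⟨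
    sumBelow (a ℕ.+ (suc n ∸ a)) g                          ≈⟨ sum-length g (NP.m+[n∸m]≡n a≤n+1) ⟩
    sumBelow (suc n) g                                      ∎
  ... | no a≰n+1 = begin
    sumBelow (suc n ∸ a) (λ t → g (a ℕ.+ t))  ≈⟨ sum-length _ (NP.m≤n⇒m∸n≡0 (NP.<⇒≤ n+1<a)) ⟩
    0#                                        ≈⟨ sum-vanishes (suc n) (λ i i<n+1 → below i (NP.<-trans i<n+1 n+1<a)) ⟨
    sumBelow (suc n) g                        ∎
    where
    n+1<a = NP.≰⇒> a≰n+1

-- The binomial expectation and the expansion of N in falling factorials

module Expansion {c ℓr : Level} (R : CommutativeRing c ℓr) (p : CommutativeRing.Carrier R) where
  open CommutativeRing R hiding (zero)
  open Binomial R
  open Sums R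
  open import Relation.Binary.Reasoning.Setoid setoid
  open import Algebra.Solver.Ring.NaturalCoefficients.Default commutativeSemiring

  ι-+ : ∀ a b → ι (a ℕ.+ b) ≈ ι a + ι b
  ι-+ zero    b = sym (+-identityˡ _)
  ι-+ (suc a) b = trans (+-congˡ (ι-+ a b)) (sym (+-assoc _ _ _))

  ι-* : ∀ a b → ι (a ℕ.* b) ≈ ι a * ι b
  ι-* zero    b = sym (zeroˡ _)
  ι-* (suc a) b = begin
    ι (b ℕ.+ a ℕ.* b)       ≈⟨ ι-+ b (a ℕ.* b) ⟩
    ι b + ι (a ℕ.* b)       ≈⟨ +-cong (sym (*-identityˡ _)) (ι-* a b) ⟩
    1# * ι b + ι a * ι b    ≈⟨ distribʳ _ _ _ ⟨
    (1# + ι a) * ι b        ∎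

  ι-≡ : ∀ {a b} → a ≡ b → ι a ≈ ι b
  ι-≡ a≡b = reflexive (Eq.cong ι a≡b)

  -- Binomial expectation  E n h = Σ_{i ≤ n} C(n,i) p^i q^(n-i) h(i),  with q = 1 - p;
  -- its weights are those of the definition of N at ℓ = n + 1.

  q : Carrier
  q = 1# - p

  q+p≈1 : ∀ x → q * x + p * x ≈ x
  q+p≈1 x = begin
    q * x + p * x          ≈⟨ distribʳ x q p ⟨
    (1# + - p + p) * x     ≈⟨ *-congʳ (+-assoc 1# (- p) p) ⟩
    (1# + (- p + p)) * x   ≈⟨ *-congʳ (+-congˡ (-‿inverseˡ p)) ⟩
    (1# + 0#) * x          ≈⟨ *-congʳ (+-identityʳ 1#) ⟩
    1# * x                 ≈⟨ *-identityˡ x ⟩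
    x                      ∎

  w : ℕ → ℕ → Carrier
  w n i = weight p (suc n) i

  E : ℕ → (ℕ → Carrier) → Carrier
  E n h = sumBelow (suc n) (λ i → w n i * h i)

  E-cong : ∀ n {h h′ : ℕ → Carrier} → (∀ i → h i ≈ h′ i) → E n h ≈ E n h′
  E-cong n h≈h′ = sum-cong (suc n) (λ i → *-congˡ (h≈h′ i))

  E-+ : ∀ n (h h′ : ℕ → Carrier) → E n (λ i → h i + h′ i) ≈ E n h + E n h′
  E-+ n h h′ = trans (sum-cong (suc n) (λ i → distribˡ _ _ _))
    (sum-+ (suc n) (λ i → w n i * h i) (λ i → w n i * h′ i))

  E-* : ∀ n x (h : ℕ → Carrier) → E n (λ i → x * h i) ≈ x * E n h
  E-* n x h = trans (sum-cong (suc n)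
      (λ i → solve 3 (λ a x b → a :* (x :* b) := x :* (a :* b)) refl (w n i) x (h i)))
    (sym (sum-*ˡ (suc n) x (λ i → w n i * h i)))

  E-sum : ∀ n K (F : ℕ → ℕ → Carrier) →
          E n (λ i → sumBelow K (F i)) ≈ sumBelow K (λ j → E n (λ i → F i j))
  E-sum n K F = trans (sum-cong (suc n) (λ i → sum-*ˡ K (w n i) (F i)))
    (sum-swap (suc n) K (λ i j → w n i * F i j))

  -- Pascal's rule C(n+1,t+1) = C(n,t) + C(n,t+1) turns into a recursion for E in n
  E-pascal : ∀ n (h : ℕ → Carrier) → E (suc n) h ≈ q * E n h + p * E n (λ i → h (suc i))
  E-pascal n h = begin
    E (suc n) h
      ≈⟨ sum-head (suc n) _ ⟩
    w (suc n) 0 * h 0 + sumBelow (suc n) (λ t → w (suc n) (suc t) * h (suc t))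
      ≈⟨ +-cong first (trans (sum-cong (suc n) split) (sum-+ (suc n) _ _)) ⟩
    q * (w n 0 * h 0) + (sumBelow (suc n) (λ t → p * (w n t * h (suc t))) + sumBelow (suc n) upper)
      ≈⟨ +-congˡ (+-cong (sym (sum-*ˡ (suc n) p _)) upper-sum) ⟩
    q * (w n 0 * h 0) + (p * E n (λ i → h (suc i)) + q * rest)
      ≈⟨ solve 5 (λ q x p e r → q :* x :+ (p :* e :+ q :* r) := q :* (x :+ r) :+ p :* e)
           refl q _ p _ rest ⟩
    q * (w n 0 * h 0 + rest) + p * E n (λ i → h (suc i))
      ≈⟨ +-congʳ (*-congˡ (sum-head n (λ i → w n i * h i))) ⟨
    q * E n h + p * E n (λ i → h (suc i)) ∎
    where
    rest : Carrier
    rest = sumBelow n (λ t → w n (suc t) * h (suc t))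
    -- the contribution of C(n, t+1) to the (t+1)-st term of E (suc n) h
    upper : ℕ → Carrier
    upper t = ι (n C suc t) * (p * pow p t * pow q (n ∸ t)) * h (suc t)
    first : w (suc n) 0 * h 0 ≈ q * (w n 0 * h 0)
    first = solve 5 (λ a o q Q x → a :* (o :* (q :* Q)) :* x := q :* (a :* (o :* Q) :* x)) refl
              (ι 1) 1# q (pow q n) (h 0)
    split : ∀ t → w (suc n) (suc t) * h (suc t) ≈ p * (w n t * h (suc t)) + upper t
    split t = begin
      ι (suc n C suc t) * (p * pow p t * pow q (n ∸ t)) * h (suc t)
        ≈⟨ *-congʳ (*-congʳ (trans (ι-≡ (Eq.sym (nCk+nC[k+1]≡[n+1]C[k+1] n t)))
                                   (ι-+ (n C t) (n C suc t)))) ⟩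
      (ι (n C t) + ι (n C suc t)) * (p * pow p t * pow q (n ∸ t)) * h (suc t)
        ≈⟨ solve 6 (λ a b p P Q x → (a :+ b) :* (p :* P :* Q) :* x
                      := p :* (a :* (P :* Q) :* x) :+ b :* (p :* P :* Q) :* x) refl _ _ _ _ _ _ ⟩
      p * (w n t * h (suc t)) + upper t ∎
    upper-last : upper n ≈ 0#
    upper-last = trans (*-congʳ (trans (*-congʳ (ι-≡ (k>n⇒nCk≡0 (NP.n<1+n n)))) (zeroˡ _))) (zeroˡ _)
    upper-inner : ∀ t → t < n → upper t ≈ q * (w n (suc t) * h (suc t))
    upper-inner t t<n = begin
      ι (n C suc t) * (p * pow p t * pow q (n ∸ t)) * h (suc t)
        ≈⟨ *-congʳ (*-congˡ (*-congˡ (reflexive (Eq.cong (pow q) (NP.+-∸-assoc 1 t<n))))) ⟩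
      ι (n C suc t) * (p * pow p t * (q * pow q (n ∸ suc t))) * h (suc t)
        ≈⟨ solve 6 (λ a p P q Q x → a :* (p :* P :* (q :* Q)) :* x := q :* (a :* (p :* P :* Q) :* x))
             refl _ _ _ _ _ _ ⟩
      q * (w n (suc t) * h (suc t)) ∎
    upper-sum : sumBelow (suc n) upper ≈ q * rest
    upper-sum = begin
      sumBelow n upper + upper n
        ≈⟨ +-cong (sum-cong< n upper-inner) upper-last ⟩
      sumBelow n (λ t → q * (w n (suc t) * h (suc t))) + 0#
        ≈⟨ +-identityʳ _ ⟩
      sumBelow n (λ t → q * (w n (suc t) * h (suc t)))
        ≈⟨ sum-*ˡ n q _ ⟨
      q * rest ∎

  E-zero : ∀ (h : ℕ → Carrier) → E 0 h ≈ h 0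
  E-zero h = begin
    0# + ι 1 * (1# * 1#) * h 0   ≈⟨ +-identityˡ _ ⟩
    ι 1 * (1# * 1#) * h 0        ≈⟨ *-congʳ (*-cong (+-identityʳ 1#) (*-identityˡ 1#)) ⟩
    1# * 1# * h 0                ≈⟨ *-congʳ (*-identityˡ 1#) ⟩
    1# * h 0                     ≈⟨ *-identityˡ _ ⟩
    h 0                          ∎

  moment : ∀ n m → E n (λ i → ι (falling i m)) ≈ ι (falling n m) * pow p m
  moment zero zero    = trans (E-zero (λ i → ι (falling i 0))) (sym (*-identityʳ _))
  moment zero (suc m) = trans (E-zero (λ i → ι (falling i (suc m)))) (sym (zeroˡ _))
  moment (suc n) zero = begin
    E (suc n) (λ _ → ι 1)                       ≈⟨ E-pascal n (λ _ → ι 1) ⟩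
    q * E n (λ _ → ι 1) + p * E n (λ _ → ι 1)   ≈⟨ q+p≈1 _ ⟩
    E n (λ _ → ι 1)                             ≈⟨ moment n zero ⟩
    ι 1 * 1#                                    ∎
  moment (suc n) (suc m) = begin
    E (suc n) (λ i → ι (falling i (suc m)))
      ≈⟨ E-pascal n _ ⟩
    q * E n (λ i → ι (falling i (suc m))) + p * E n (λ i → ι (falling (suc i) (suc m)))
      ≈⟨ +-congˡ (*-congˡ (E-cong n ι-pascal)) ⟩
    q * E n (λ i → ι (falling i (suc m)))
      + p * E n (λ i → ι (falling i (suc m)) + ι (suc m) * ι (falling i m))
      ≈⟨ +-congˡ (*-congˡ (trans (E-+ n _ _) (+-congˡ (E-* n _ _)))) ⟩
    q * E n (λ i → ι (falling i (suc m)))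
      + p * (E n (λ i → ι (falling i (suc m))) + ι (suc m) * E n (λ i → ι (falling i m)))
      ≈⟨ +-cong (*-congˡ (moment n (suc m)))
                (*-congˡ (+-cong (moment n (suc m)) (*-congˡ (moment n m)))) ⟩
    q * Z + p * (Z + ι (suc m) * (Y * pow p m))
      ≈⟨ solve 4 (λ q p Z W → q :* Z :+ p :* (Z :+ W) := (q :* Z :+ p :* Z) :+ p :* W) refl _ _ _ _ ⟩
    (q * Z + p * Z) + p * (ι (suc m) * (Y * pow p m))
      ≈⟨ +-congʳ (q+p≈1 Z) ⟩
    Z + p * (ι (suc m) * (Y * pow p m))
      ≈⟨ solve 5 (λ X p P c Y → X :* (p :* P) :+ p :* (c :* (Y :* P)) := (X :+ c :* Y) :* (p :* P))
           refl _ _ _ _ _ ⟩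
    (ι (falling n (suc m)) + ι (suc m) * Y) * pow p (suc m)
      ≈⟨ *-congʳ (ι-pascal n) ⟨
    ι (falling (suc n) (suc m)) * pow p (suc m) ∎
    where
    Y = ι (falling n m)
    Z = ι (falling n (suc m)) * pow p (suc m)
    ι-pascal : ∀ i → ι (falling (suc i) (suc m)) ≈ ι (falling i (suc m)) + ι (suc m) * ι (falling i m)
    ι-pascal i = trans (ι-≡ (falling-pascal i m))
      (trans (ι-+ (falling i (suc m)) (suc m ℕ.* falling i m)) (+-congˡ (ι-* (suc m) (falling i m))))

  basis : ℕ → ℕ → Carrier
  basis ℓ J = ι (ℓ ℕ.* falling ℓ J)

  Φ : ℕ → (ℕ → Carrier) → ℕ → Carrier
  Φ K g ℓ = sumBelow K (λ j → basis ℓ j * g j)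

  σ : (ℕ → Carrier) → ℕ → Carrier
  σ g zero          = 0#
  σ g (suc zero)    = 0#
  σ g (suc (suc j)) = pow p (suc j) * (ι (suc j) * g (suc j) + g j)

  basis-absorb : ∀ i j → basis i j ≈ ι (falling i (suc j)) + ι j * ι (falling i j)
  basis-absorb i j = trans (ι-≡ (falling-absorb i j))
    (trans (ι-+ (falling i (suc j)) (j ℕ.* falling i j)) (+-congˡ (ι-* j (falling i j))))

  basis-square : ∀ n m → ι (suc n ℕ.* suc n) * ι (falling n m) ≈ basis (suc n) (suc m)
  basis-square n m = begin
    ι (suc n ℕ.* suc n) * ι (falling n m)   ≈⟨ ι-* (suc n ℕ.* suc n) (falling n m) ⟨
    ι (suc n ℕ.* suc n ℕ.* falling n m)     ≈⟨ ι-≡ (NP.*-assoc (suc n) (suc n) (falling n m)) ⟩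
    basis (suc n) (suc m)                   ∎

  E-Φ : ∀ n K g → E n (Φ K g) ≈
    sumBelow K (λ j → g j * (ι (falling n (suc j)) * pow p (suc j) + ι j * (ι (falling n j) * pow p j)))
  E-Φ n K g = begin
    E n (Φ K g)
      ≈⟨ E-cong n (λ i → sum-cong K (λ j → trans (*-congʳ (basis-absorb i j)) (*-comm _ _))) ⟩
    E n (λ i → sumBelow K (λ j → g j * (ι (falling i (suc j)) + ι j * ι (falling i j))))
      ≈⟨ E-sum n K _ ⟩
    sumBelow K (λ j → E n (λ i → g j * (ι (falling i (suc j)) + ι j * ι (falling i j))))
      ≈⟨ sum-cong K moments ⟩
    sumBelow K (λ j → g j * (ι (falling n (suc j)) * pow p (suc j) + ι j * (ι (falling n j) * pow p j))) ∎
    where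
    moments : ∀ j → E n (λ i → g j * (ι (falling i (suc j)) + ι j * ι (falling i j)))
                  ≈ g j * (ι (falling n (suc j)) * pow p (suc j) + ι j * (ι (falling n j) * pow p j))
    moments j = trans (E-* n (g j) _) (*-congˡ (trans (E-+ n _ _)
      (+-cong (moment n (suc j)) (trans (E-* n (ι j) _) (*-congˡ (moment n j))))))

  -- collecting the coefficient of each basis element a_J produces σ g
  σ-collect : ∀ K (g a : ℕ → Carrier) → g K ≈ 0# →
    sumBelow K (λ j → g j * (a (suc (suc j)) * pow p (suc j) + ι j * a (suc j) * pow p j))
      ≈ sumBelow (suc (suc K)) (λ J → a J * σ g J)
  σ-collect K g a gK≈0 = begin
    sumBelow K (λ j → g j * (a (suc (suc j)) * pow p (suc j) + ι j * a (suc j) * pow p j))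
      ≈⟨ sum-cong K (λ j → solve 6 (λ g a₂ P₁ c a₁ P → g :* (a₂ :* P₁ :+ c :* a₁ :* P)
                                      := g :* a₂ :* P₁ :+ c :* g :* a₁ :* P) refl
            (g j) (a (suc (suc j))) (pow p (suc j)) (ι j) (a (suc j)) (pow p j)) ⟩
    sumBelow K (λ j → H j + G j)                ≈⟨ sum-+ K H G ⟩
    sumBelow K H + sumBelow K G                 ≈⟨ +-congˡ (sum-shift K G G0≈0 GK≈0) ⟩
    sumBelow K H + sumBelow K (λ j → G (suc j)) ≈⟨ sum-+ K H (λ j → G (suc j)) ⟨
    sumBelow K (λ j → H j + G (suc j))          ≈⟨ sum-cong K σ-term ⟨
    sumBelow K (λ j → a (suc (suc j)) * σ g (suc (suc j)))
      ≈⟨ sum-drop-head K (λ J → a (suc J) * σ g (suc J)) (zeroʳ _) ⟨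
    sumBelow (suc K) (λ J → a (suc J) * σ g (suc J))
      ≈⟨ sum-drop-head (suc K) (λ J → a J * σ g J) (zeroʳ _) ⟨
    sumBelow (suc (suc K)) (λ J → a J * σ g J) ∎
    where
    -- contributions of g j to the basis elements a_{j+2} and a_{j+1}
    H G : ℕ → Carrier
    H j = g j * a (suc (suc j)) * pow p (suc j)
    G j = ι j * g j * a (suc j) * pow p j
    G0≈0 : G 0 ≈ 0#
    G0≈0 = trans (*-congʳ (trans (*-congʳ (zeroˡ _)) (zeroˡ _))) (zeroˡ _)
    GK≈0 : G K ≈ 0#
    GK≈0 = trans (*-congʳ (trans (*-congʳ (trans (*-congˡ gK≈0) (zeroʳ _))) (zeroˡ _))) (zeroˡ _)
    σ-term : ∀ j → a (suc (suc j)) * σ g (suc (suc j)) ≈ H j + G (suc j)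
    σ-term j = solve 5 (λ a P c g₁ g₀ → a :* (P :* (c :* g₁ :+ g₀)) := g₀ :* a :* P :+ c :* g₁ :* a :* P)
      refl (a (suc (suc j))) (pow p (suc j)) (ι (suc j)) (g (suc j)) (g j)

  E-step : ∀ n K g → g K ≈ 0# → ι (suc n ℕ.* suc n) * E n (Φ K g) ≈ Φ (suc (suc K)) (σ g) (suc n)
  E-step n K g gK≈0 = begin
    ℓ² * E n (Φ K g)
      ≈⟨ *-congˡ (E-Φ n K g) ⟩
    ℓ² * sumBelow K (λ j → g j * (ι (falling n (suc j)) * pow p (suc j) + ι j * (ι (falling n j) * pow p j)))
      ≈⟨ sum-*ˡ K ℓ² _ ⟩
    sumBelow K (λ j → ℓ² * (g j * (ι (falling n (suc j)) * pow p (suc j) + ι j * (ι (falling n j) * pow p j))))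
      ≈⟨ sum-cong K scale ⟩
    sumBelow K (λ j → g j * (basis (suc n) (suc (suc j)) * pow p (suc j) + ι j * basis (suc n) (suc j) * pow p j))
      ≈⟨ σ-collect K g (basis (suc n)) gK≈0 ⟩
    Φ (suc (suc K)) (σ g) (suc n) ∎
    where
    ℓ² = ι (suc n ℕ.* suc n)
    scale : ∀ j → ℓ² * (g j * (ι (falling n (suc j)) * pow p (suc j) + ι j * (ι (falling n j) * pow p j)))
                ≈ g j * (basis (suc n) (suc (suc j)) * pow p (suc j) + ι j * basis (suc n) (suc j) * pow p j)
    scale j = trans
      (solve 7 (λ c g X P₁ d Y P → c :* (g :* (X :* P₁ :+ d :* (Y :* P)))
                                   := g :* ((c :* X) :* P₁ :+ d :* (c :* Y) :* P)) refl
        ℓ² (g j) (ι (falling n (suc j))) (pow p (suc j)) (ι j) (ι (falling n j)) (pow p j))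
      (*-congˡ (+-cong (*-congʳ (basis-square n (suc j))) (*-congʳ (*-congˡ (basis-square n j)))))

  -- Φ_g vanishes at every ℓ < a when g is supported in [a, ∞), since (ℓ)_j = 0 for j > ℓ
  Φ-vanishes : ∀ K a g → (∀ j → j < a → g j ≈ 0#) → ∀ ℓ → ℓ < a → Φ K g ℓ ≈ 0#
  Φ-vanishes K a g below ℓ ℓ<a = sum-vanishes K term
    where
    term : ∀ j → j < K → basis ℓ j * g j ≈ 0#
    term j _ with j NP.<? a
    ... | yes j<a = trans (*-congˡ (below j j<a)) (zeroʳ _)
    ... | no  j≮a = trans (*-congʳ (ι-≡ (Eq.trans (Eq.cong (ℓ ℕ.*_) (falling-vanishes ℓ j ℓ<j))
                                                    (NP.*-zeroʳ ℓ))))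
                          (zeroˡ _)
      where ℓ<j = NP.<-≤-trans ℓ<a (NP.≮⇒≥ j≮a)

  -- one level of the recursion defining N, applied to a falling-factorial polynomial
  N-step : ∀ K g a ℓ → g K ≈ 0# → (∀ i → i < a → Φ K g i ≈ 0#) →
    ι (ℓ ℕ.* ℓ) * sumFromTo a (ℓ ∸ 1) (λ i → Φ K g i * weight p ℓ i) ≈ Φ (suc (suc K)) (σ g) ℓ
  N-step K g a zero    _     _     = trans (zeroˡ _) (sym (sum-vanishes (suc (suc K)) (λ _ _ → zeroˡ _)))
  N-step K g a (suc n) gK≈0 below = begin
    ι (suc n ℕ.* suc n) * sumFromTo a n (λ i → Φ K g i * w n i)
      ≈⟨ *-congˡ (sumFromTo-extend a n _ (λ i i<a → trans (*-congʳ (below i i<a)) (zeroˡ _))) ⟩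
    ι (suc n ℕ.* suc n) * sumBelow (suc n) (λ i → Φ K g i * w n i)
      ≈⟨ *-congˡ (sum-cong (suc n) (λ i → *-comm _ _)) ⟩
    ι (suc n ℕ.* suc n) * E n (Φ K g)
      ≈⟨ E-step n K g gK≈0 ⟩
    Φ (suc (suc K)) (σ g) (suc n) ∎

  -- The coefficients:  f_1 = [j = 1]  and  f_{k+1} = σ f_k  (f_0 = 0 only makes f total)
  f : ℕ → ℕ → Carrier
  f zero          j          = 0#
  f (suc zero)    (suc zero) = 1#
  f (suc zero)    _          = 0#
  f (suc (suc k)) j          = σ (f (suc k)) j

  σ-vanishes : ∀ g j → g (suc j) ≈ 0# → g j ≈ 0# → σ g (suc (suc j)) ≈ 0#
  σ-vanishes g j g[j+1]≈0 gj≈0 =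
    trans (*-congˡ (trans (+-cong (trans (*-congˡ g[j+1]≈0) (zeroʳ _)) gj≈0) (+-identityʳ 0#))) (zeroʳ _)

  σ-below : ∀ a g → (∀ j → j < a → g j ≈ 0#) → ∀ J → J < suc a → σ g J ≈ 0#
  σ-below a g below zero          _            = refl
  σ-below a g below (suc zero)    _            = refl
  σ-below a g below (suc (suc j)) (s≤s j+1<a) =
    σ-vanishes g j (below (suc j) j+1<a) (below j (NP.<⇒≤ j+1<a))

  σ-above : ∀ b g → (∀ j → b ≤ j → g j ≈ 0#) → ∀ J → suc (suc b) ≤ J → σ g J ≈ 0#
  σ-above b g above (suc (suc j)) (s≤s (s≤s b≤j)) =
    σ-vanishes g j (above (suc j) (NP.m≤n⇒m≤1+n b≤j)) (above j b≤j)

  f-below : ∀ k j → j < k → f k j ≈ 0#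
  f-below (suc zero)    zero    _           = refl
  f-below (suc zero)    (suc j) (s≤s ())
  f-below (suc (suc k)) j       j<k        = σ-below (suc k) (f (suc k)) (f-below (suc k)) j j<k

  f-above : ∀ k j → twice k ≤ j → f k j ≈ 0#
  f-above zero          j             _     = refl
  f-above (suc zero)    (suc (suc j)) _     = refl
  f-above (suc zero)    (suc zero)    (s≤s ())
  f-above (suc (suc k)) j             2k≤j = σ-above (twice (suc k)) (f (suc k)) (f-above (suc k)) j 2k≤j

  Φ-f₁ : ∀ i → Φ 2 (f 1) i ≈ ι (i ℕ.* i)
  Φ-f₁ i = begin
    (0# + basis i 0 * 0#) + basis i 1 * 1#   ≈⟨ +-cong (trans (+-identityˡ _) (zeroʳ _)) (*-identityʳ _) ⟩
    0# + basis i 1                           ≈⟨ +-identityˡ _ ⟩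
    ι (i ℕ.* falling i 1)                    ≈⟨ ι-≡ (Eq.cong (i ℕ.*_) (falling-one i)) ⟩
    ι (i ℕ.* i)                              ∎

  N≈Φ : ∀ k ℓ → N (suc (suc k)) ℓ p ≈ Φ (twice (suc (suc k))) (f (suc (suc k))) ℓ
  N≈Φ zero ℓ = begin
    ι (ℓ ℕ.* ℓ) * sumFromTo 1 (ℓ ∸ 1) (λ i → ι (i ℕ.* i) * weight p ℓ i)
      ≈⟨ *-congˡ (sum-cong (ℓ ∸ 1) (λ t → *-congʳ (sym (Φ-f₁ (suc t))))) ⟩
    ι (ℓ ℕ.* ℓ) * sumFromTo 1 (ℓ ∸ 1) (λ i → Φ 2 (f 1) i * weight p ℓ i)
      ≈⟨ N-step 2 (f 1) 1 ℓ refl (Φ-vanishes 2 1 (f 1) (f-below 1)) ⟩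
    Φ 4 (f 2) ℓ ∎
  N≈Φ (suc k) ℓ = begin
    ι (ℓ ℕ.* ℓ) * sumFromTo K (ℓ ∸ 1) (λ i → N K i p * weight p ℓ i)
      ≈⟨ *-congˡ (sum-cong (suc (ℓ ∸ 1) ∸ K) (λ t → *-congʳ (N≈Φ k (K ℕ.+ t)))) ⟩
    ι (ℓ ℕ.* ℓ) * sumFromTo K (ℓ ∸ 1) (λ i → Φ (twice K) (f K) i * weight p ℓ i)
      ≈⟨ N-step (twice K) (f K) K ℓ (f-above K (twice K) NP.≤-refl) (Φ-vanishes (twice K) K (f K) (f-below K)) ⟩
    Φ (twice (suc K)) (f (suc K)) ℓ ∎
    where
    K = suc (suc k)

  N-expansion : ∀ k ℓ → let K = suc (suc k) in
    N K ℓ p ≈ sumFromTo K (2 ℕ.* K ∸ 1) (λ j → ι (ℓ ℕ.* (ℓ P j)) * f K j)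
  N-expansion k ℓ = begin
    N K ℓ p
      ≈⟨ N≈Φ k ℓ ⟩
    sumBelow (twice K) (λ j → basis ℓ j * f K j)
      ≈⟨ sum-length _ (twice≡2* K) ⟩
    sumBelow (suc (2 ℕ.* K ∸ 1)) (λ j → basis ℓ j * f K j)
      ≈⟨ sumFromTo-extend K (2 ℕ.* K ∸ 1) _ (λ j j<K → trans (*-congˡ (f-below K j j<K)) (zeroʳ _)) ⟨
    sumFromTo K (2 ℕ.* K ∸ 1) (λ j → basis ℓ j * f K j)
      ≈⟨ sum-cong (suc (2 ℕ.* K ∸ 1) ∸ K)
           (λ t → *-congʳ (ι-≡ (Eq.cong (ℓ ℕ.*_) (Eq.sym (P≡falling ℓ (K ℕ.+ t)))))) ⟩
    sumFromTo K (2 ℕ.* K ∸ 1) (λ j → ι (ℓ ℕ.* (ℓ P j)) * f K j) ∎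
    where
    K = suc (suc k)

  f-vanishes-below : ∀ k i → 1 ≤ i → i ≤ k → f k (k ∸ i) ≈ 0#
  f-vanishes-below (suc k) (suc i) _ _ = f-below (suc k) (k ∸ i) (s≤s (NP.m∸n≤m k i))

  f-vanishes-above : ∀ k i → f k (2 ℕ.* k ℕ.+ i) ≈ 0#
  f-vanishes-above k i =
    f-above k (2 ℕ.* k ℕ.+ i) (NP.≤-trans (NP.≤-reflexive (twice≡2* k)) (NP.m≤m+n (2 ℕ.* k) i))

  f-recursion : ∀ k j → 2 ≤ j →
    f (suc (suc k)) j ≈ pow p (j ∸ 1) * (ι (j ∸ 1) * f (suc k) (j ∸ 1) + f (suc k) (j ∸ 2))
  f-recursion k (suc (suc j)) _        = refl
  f-recursion k (suc zero)    (s≤s ())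

lemma2 : {c ℓr : Level} (R : CommutativeRing c ℓr) →
    let open CommutativeRing R
        open Binomial R
    in (p : Carrier) →
       Σ (ℕ → ℕ → Carrier) λ f →
         (k : ℕ) → 2 ≤ k →
           ((ℓ : ℕ) → 1 ≤ ℓ →
              N k ℓ p ≈ sumFromTo k (2 ℕ.* k ∸ 1) (λ j → ι (ℓ ℕ.* (ℓ P j)) * f k j))
           × ((i : ℕ) → 1 ≤ i → i ≤ k → f k (k ∸ i) ≈ 0#)
           × ((i : ℕ) → f k (2 ℕ.* k ℕ.+ i) ≈ 0#)
           × ((j : ℕ) → 2 ≤ j →
                f (suc k) j ≈ pow p (j ∸ 1) * (ι (j ∸ 1) * f k (j ∸ 1) + f k (j ∸ 2)))
lemma2 R p = f , λ where
    (suc (suc k)) _ → (λ ℓ _ → N-expansion k ℓ)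
                    , f-vanishes-below (suc (suc k))
                    , f-vanishes-above (suc (suc k))
                    , f-recursion (suc k)
    (suc zero) (s≤s ())
  where open Expansion R p
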